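{- For all $n\geq 2$, the number of desarrangements of length $n$ avoiding both $132$ and $231$ is $d_n(132,231)=2^{n-2}$.
   Context: Permutations are in one-line notation. An index $i\in[n-1]$ is a descent of $\pi\in\mathfrak{S}_n$ if $\pi_i>\pi_{i+1}$; $i\in[n]$ is an ascent if it is not a descent (so $n$ is always an ascent). A desarrangement is a permutation whose first ascent is even. $d_n(\Pi)$ is the number of desarrangements in $\mathfrak{S}_n$ avoiding every pattern in $\Pi$ ($\pi$ avoids $\sigma$ if no subsequence of $\pi$ has the same relative order as $\sigma$). -}

module Defs where

open import Data.Nat using (ℕ; zero; suc; _<ᵇ_; _≡ᵇ_)
open import Data.Bool using (Bool; true; false; _∧_; _∨_; not; if_then_else_)
open import Data.Fin using (Fin; toℕ)
open import Data.List using (List; []; _∷_; length; map; concatMap; filter; allFin; _++_)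
open import Data.Product using (_×_; _,_)
open import Data.Bool.Properties using (T?)

any : {A : Set} → (A → Bool) → List A → Bool
any p [] = false
any p (x ∷ xs) = p x ∨ any p xs

all : {A : Set} → (A → Bool) → List A → Bool
all p [] = true
all p (x ∷ xs) = p x ∧ all p xs

iff : Bool → Bool → Bool
iff true b = b
iff false b = not b

-- A permutation of [n] in one-line notation is a word π₁…πₙ over {0,…,n-1}
-- (values shifted down by 1; relative order is unaffected) with distinct letters.

words : (m k : ℕ) → List (List (Fin m))
words m zero = [] ∷ []
words m (suc k) = concatMap (λ w → map (λ a → a ∷ w) (allFin m)) (words m k)

_≡ᶠ_ : {m : ℕ} → Fin m → Fin m → Bool
a ≡ᶠ b = _≡ᵇ_ (toℕ a) (toℕ b)

distinct : {m : ℕ} → List (Fin m) → Bool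
distinct [] = true
distinct (a ∷ w) = not (any (a ≡ᶠ_) w) ∧ distinct w

perms : ℕ → List (List ℕ)
perms n = map (map toℕ) (filter (λ w → T? (distinct w)) (words n n))

subseqs : List ℕ → List (List ℕ)
subseqs [] = [] ∷ []
subseqs (a ∷ w) = map (a ∷_) (subseqs w) ++ subseqs w

pairs : List ℕ → List ℕ → List (ℕ × ℕ)
pairs [] _ = []
pairs (_ ∷ _) [] = []
pairs (a ∷ u) (b ∷ v) = (a , b) ∷ pairs u v

sameOrder : List ℕ → List ℕ → Bool
sameOrder u v =
  _≡ᵇ_ (length u) (length v) ∧
  all (λ p → all (λ q → let (a , b) = p ; (c , d) = q in
                         iff (a <ᵇ c) (b <ᵇ d)) ps) ps
  where ps = pairs u v

contains : List ℕ → List ℕ → Bool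
contains π σ = any (λ s → sameOrder s σ) (subseqs π)

avoids : List ℕ → List ℕ → Bool
avoids π σ = not (contains π σ)

avoidsAll : List ℕ → List (List ℕ) → Bool
avoidsAll π Π = all (avoids π) Π

-- first ascent (1-based): the least i ∈ [n] with i = n or π_i < π_{i+1}
firstAscent : List ℕ → ℕ
firstAscent [] = 1   -- unused for n ≥ 1
firstAscent (a ∷ []) = 1
firstAscent (a ∷ b ∷ w) = if a <ᵇ b then 1 else suc (firstAscent (b ∷ w))

even : ℕ → Bool
even zero = true
even (suc zero) = false
even (suc (suc n)) = even n

isDesarrangement : List ℕ → Bool
isDesarrangement π = even (firstAscent π)

d : ℕ → List (List ℕ) → ℕ
d n Π = length (filter (λ π → T? (isDesarrangement π ∧ avoidsAll π Π)) (perms n))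

-- A permutation avoids both 132 and 231 exactly when it has no peak: no entries
-- a, b, c, in this order, with b larger than a and c. In a peak-free permutation of
-- {0, …, k} the maximum k stands first or last, and removing it leaves a peak-free
-- permutation of {0, …, k-1}; conversely k may be added at either end. Adding k in
-- front shifts the first ascent by one, adding it at the back leaves it unchanged.
-- Hence the peak-free permutations of {0, …, k} with even first ascent correspond
-- to all peak-free permutations of {0, …, k-1}, of which there are 2^(k-1).
module Submission where

open import Defs
open import Data.Bool using (Bool; true; false; T; not; _∧_)
open import Data.Bool.Properties using (T?; T-∧; T-∨; T-≡; ¬-not; not-involutive)
open import Data.Fin using (Fin; toℕ; fromℕ<)
open import Data.Fin.Properties using (toℕ<n; toℕ-fromℕ<; toℕ-injective)
open import Data.List
  using (List; []; _∷_; _++_; [_]; length; map; filter; reverse; allFin; upTo; concatMap; cartesianProductWith)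
open import Data.List.Properties
  using (length-++; length-map; length-filter; length-upTo; ++-identityʳ; reverse-++; reverse-involutive;
         ∷-injectiveˡ; ∷-injectiveʳ; ∷ʳ-injectiveˡ; map-injective)
open import Data.List.Membership.Propositional using (_∈_; _∉_; find; lose)
open import Data.List.Membership.Propositional.Properties
  using (∈-map⁺; ∈-map⁻; ∈-++⁺ˡ; ∈-++⁺ʳ; ∈-++⁻; ∈-∃++; ∈-allFin; ∈-upTo⁺; ∈-filter⁺; ∈-filter⁻;
         ∈-cartesianProductWith⁺; ∈-cartesianProductWith⁻)
open import Data.List.Membership.Propositional.Properties.WithK using (unique∧set⇒bag)
open import Data.List.Relation.Unary.All as All using (All; []; _∷_)
open import Data.List.Relation.Unary.All.Properties as AllP using (¬Any⇒All¬; All¬⇒¬Any)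
open import Data.List.Relation.Unary.Any as Any using (Any; here; there)
open import Data.List.Relation.Unary.Unique.Propositional using (Unique; []; _∷_)
import Data.List.Relation.Unary.Unique.Propositional.Properties as UniqueP
open import Data.List.Relation.Binary.Disjoint.Propositional using (Disjoint)
open import Data.List.Relation.Binary.BagAndSetEquality using (_∼[_]_; set; ∼bag⇒↭)
open import Data.List.Relation.Binary.Permutation.Propositional using (_↭_; ↭-sym; ↭⇒↭ₛ)
open import Data.List.Relation.Binary.Permutation.Propositional.Properties
  using (↭-length; All-resp-↭; shift; ↭-reverse)
open import Data.List.Relation.Binary.Permutation.Setoid.Properties using (Unique-resp-↭)
open import Data.List.Relation.Binary.Sublist.Propositional using (_⊆_; []; _∷_; _∷ʳ_; ⊆-refl; ⊆-trans)
open import Data.List.Relation.Binary.Sublist.Propositional.Properties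
  using (All-resp-⊆; reverse⁺; ++⁺ˡ; ++⁺ʳ; []⊆-universal)
open import Data.Nat using (ℕ; zero; suc; _+_; _^_; _∸_; _≤_; _<_; _<ᵇ_; s≤s; s≤s⁻¹; z<s; s<s)
open import Data.Nat.Properties
  using (<ᵇ⇒<; <⇒<ᵇ; ≡ᵇ⇒≡; ≡⇒≡ᵇ; <-cmp; <-irrefl; <-trans; <-asym; <⇒≤; ≤⇒≯; ≤∧≢⇒<; ≤-refl; m<n⇒m<1+n; n<1+n;
         1+n≰n; suc-injective; +-identityʳ; _≟_; module ≤-Reasoning)
open import Data.List.Membership.DecPropositional _≟_ using (_∈?_)
open import Data.Product using (∃; _×_; _,_; proj₁; proj₂; uncurry)
open import Data.Sum using (_⊎_; inj₁; inj₂)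
open import Function using (_∘_; const)
open import Function.Bundles using (_⇔_; mk⇔; Equivalence)
import Function.Properties.Equivalence as ⇔
open import Relation.Binary using (tri<; tri≈; tri>)
open import Relation.Binary.PropositionalEquality
  using (_≡_; _≢_; refl; sym; trans; cong; cong₂; subst; setoid; module ≡-Reasoning)
open import Relation.Nullary using (¬_; Dec; yes; no; contradiction)

open Equivalence using (to; from)

T-not : ∀ {x} → T (not x) ⇔ (¬ T x)
T-not {true} = mk⇔ (λ ()) (λ ¬t → ¬t _)
T-not {false} = mk⇔ (λ _ ()) (const _)

T-iff : ∀ x y → T (iff x y) → T y → T x
T-iff true _ _ _ = _
T-iff false true () _

<ᵇ≡true : ∀ {m n} → m < n → (m <ᵇ n) ≡ true
<ᵇ≡true = to T-≡ ∘ <⇒<ᵇ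

<ᵇ≡false : ∀ {m n} → n ≤ m → (m <ᵇ n) ≡ false
<ᵇ≡false n≤m = ¬-not (λ m<ᵇn → ≤⇒≯ n≤m (<ᵇ⇒< _ _ (from T-≡ m<ᵇn)))

module _ {A : Set} {p : A → Bool} where

  T-any : ∀ {xs} → T (any p xs) ⇔ Any (T ∘ p) xs
  T-any {xs} = mk⇔ (to′ xs) (from′ xs)
    where
    to′ : ∀ xs → T (any p xs) → Any (T ∘ p) xs
    to′ (x ∷ xs) t with to T-∨ t
    ... | inj₁ px = here px
    ... | inj₂ t′ = there (to′ xs t′)

    from′ : ∀ xs → Any (T ∘ p) xs → T (any p xs)
    from′ (x ∷ xs) (here px) = from T-∨ (inj₁ px)
    from′ (x ∷ xs) (there a) = from T-∨ (inj₂ (from′ xs a))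

  T-all : ∀ {xs} → T (all p xs) ⇔ All (T ∘ p) xs
  T-all {xs} = mk⇔ (to′ xs) (from′ xs)
    where
    to′ : ∀ xs → T (all p xs) → All (T ∘ p) xs
    to′ [] _ = []
    to′ (x ∷ xs) t = let px , t′ = to T-∧ t in px ∷ to′ xs t′

    from′ : ∀ xs → All (T ∘ p) xs → T (all p xs)
    from′ [] [] = _
    from′ (x ∷ xs) (px ∷ a) = from T-∧ (px , from′ xs a)

data Peak (x : List ℕ) : Set where
  peak : ∀ {a b c} → a ∷ b ∷ c ∷ [] ⊆ x → a < b → c < b → Peak x

∈-subseqs⁻ : ∀ x {s} → s ∈ subseqs x → s ⊆ x
∈-subseqs⁻ [] (here refl) = []
∈-subseqs⁻ (a ∷ x) s∈ with ∈-++⁻ (map (a ∷_) (subseqs x)) s∈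
... | inj₁ s∈ˡ with s′ , s′∈ , refl ← ∈-map⁻ (a ∷_) s∈ˡ = refl ∷ ∈-subseqs⁻ x s′∈
... | inj₂ s∈ʳ = a ∷ʳ ∈-subseqs⁻ x s∈ʳ

∈-subseqs⁺ : ∀ {s x} → s ⊆ x → s ∈ subseqs x
∈-subseqs⁺ [] = here refl
∈-subseqs⁺ {x = a ∷ x} (_ ∷ʳ s⊆x) = ∈-++⁺ʳ (map (a ∷_) (subseqs x)) (∈-subseqs⁺ s⊆x)
∈-subseqs⁺ (refl ∷ s⊆x) = ∈-++⁺ˡ (∈-map⁺ _ (∈-subseqs⁺ s⊆x))

T-contains : ∀ {x σ} → T (contains x σ) ⇔ (∃ λ s → s ⊆ x × T (sameOrder s σ))
T-contains {x} = mk⇔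
  (λ t → let s , s∈ , so = find (to T-any t) in s , ∈-subseqs⁻ x s∈ , so)
  (λ (s , s⊆x , so) → from T-any (lose (∈-subseqs⁺ s⊆x) so))

T-sameOrder : ∀ u v → T (sameOrder u v) →
              All (λ x → All (λ y → T (iff (proj₁ x <ᵇ proj₁ y) (proj₂ x <ᵇ proj₂ y))) (pairs u v))
                  (pairs u v)
T-sameOrder u v t = All.map (to T-all) (to T-all (proj₂ (to T-∧ t)))

sameOrder⇒peak : ∀ {a b c p q r} → p < q → r < q →
                 T (sameOrder (a ∷ b ∷ c ∷ []) (p ∷ q ∷ r ∷ [])) → a < b × c < b
sameOrder⇒peak {a} {b} {c} {p} {q} {r} p<q r<q t
  with T-sameOrder (a ∷ b ∷ c ∷ []) (p ∷ q ∷ r ∷ []) t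
... | (_ ∷ a?b ∷ _) ∷ _ ∷ (_ ∷ c?b ∷ _) ∷ [] =
  <ᵇ⇒< a b (T-iff _ _ a?b (<⇒<ᵇ p<q)) , <ᵇ⇒< c b (T-iff _ _ c?b (<⇒<ᵇ r<q))

contains⇒Peak : ∀ {x p q r} → p < q → r < q → T (contains x (p ∷ q ∷ r ∷ [])) → Peak x
contains⇒Peak p<q r<q t with to T-contains t
... | _ ∷ _ ∷ _ ∷ [] , s⊆x , so = uncurry (peak s⊆x) (sameOrder⇒peak p<q r<q so)
... | [] , _ , ()
... | _ ∷ [] , _ , ()
... | _ ∷ _ ∷ [] , _ , ()
... | _ ∷ _ ∷ _ ∷ _ ∷ _ , _ , ()

σ₁₃₂ σ₂₃₁ : List ℕ
σ₁₃₂ = 1 ∷ 3 ∷ 2 ∷ []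
σ₂₃₁ = 2 ∷ 3 ∷ 1 ∷ []

Π : List (List ℕ)
Π = σ₁₃₂ ∷ σ₂₃₁ ∷ []

sameOrder-132 : ∀ {a b c} → a < c → c < b → T (sameOrder (a ∷ b ∷ c ∷ []) σ₁₃₂)
sameOrder-132 {a} {b} {c} a<c c<b
  rewrite <ᵇ≡false {a} ≤-refl | <ᵇ≡false {b} ≤-refl | <ᵇ≡false {c} ≤-refl
        | <ᵇ≡true a<c | <ᵇ≡true c<b | <ᵇ≡true (<-trans a<c c<b)
        | <ᵇ≡false (<⇒≤ a<c) | <ᵇ≡false (<⇒≤ c<b) | <ᵇ≡false (<⇒≤ (<-trans a<c c<b)) = _

sameOrder-231 : ∀ {a b c} → c < a → a < b → T (sameOrder (a ∷ b ∷ c ∷ []) σ₂₃₁)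
sameOrder-231 {a} {b} {c} c<a a<b
  rewrite <ᵇ≡false {a} ≤-refl | <ᵇ≡false {b} ≤-refl | <ᵇ≡false {c} ≤-refl
        | <ᵇ≡true c<a | <ᵇ≡true a<b | <ᵇ≡true (<-trans c<a a<b)
        | <ᵇ≡false (<⇒≤ c<a) | <ᵇ≡false (<⇒≤ a<b) | <ᵇ≡false (<⇒≤ (<-trans c<a a<b)) = _

Unique-resp-⊆ : ∀ {xs ys : List ℕ} → xs ⊆ ys → Unique ys → Unique xs
Unique-resp-⊆ [] _ = []
Unique-resp-⊆ (_ ∷ʳ xs⊆ys) (_ ∷ u) = Unique-resp-⊆ xs⊆ys u
Unique-resp-⊆ (refl ∷ xs⊆ys) (y∉ ∷ u) = All-resp-⊆ xs⊆ys y∉ ∷ Unique-resp-⊆ xs⊆ys u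

avoids-132-231⇔¬Peak : ∀ {x} → Unique x → T (avoidsAll x Π) ⇔ (¬ Peak x)
avoids-132-231⇔¬Peak {x} ux = mk⇔ avoids⇒¬Peak ¬Peak⇒avoids
  where
  contains-at : ∀ {s σ} → s ⊆ x → T (sameOrder s σ) → T (contains x σ)
  contains-at s⊆x so = from T-contains (_ , s⊆x , so)

  avoids⇒¬Peak : T (avoidsAll x Π) → ¬ Peak x
  avoids⇒¬Peak t (peak {a} {b} {c} s⊆x a<b c<b)
    with to (T-all {p = avoids x} {xs = Π}) t | Unique-resp-⊆ s⊆x ux
  ... | avoids₁₃₂ ∷ avoids₂₃₁ ∷ [] | (_ ∷ a≢c ∷ []) ∷ _ with <-cmp a c
  ...   | tri< a<c _ _ = to T-not avoids₁₃₂ (contains-at {σ = σ₁₃₂} s⊆x (sameOrder-132 a<c c<b))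
  ...   | tri≈ _ a≡c _ = a≢c a≡c
  ...   | tri> _ _ c<a = to T-not avoids₂₃₁ (contains-at {σ = σ₂₃₁} s⊆x (sameOrder-231 c<a a<b))

  ¬Peak⇒avoids : ¬ Peak x → T (avoidsAll x Π)
  ¬Peak⇒avoids ¬px = from (T-all {p = avoids x} {xs = Π})
    ( from T-not (¬px ∘ contains⇒Peak (s<s z<s) (s<s (s<s z<s)))
    ∷ from T-not (¬px ∘ contains⇒Peak (s<s (s<s z<s)) (s<s z<s))
    ∷ [])

record IsPerm (n : ℕ) (x : List ℕ) : Set where
  constructor isPerm
  field
    length≡ : length x ≡ n
    bounded : All (_< n) x
    unique  : Unique x

concatMap-map≡cartesianProductWith : ∀ {A B C : Set} (f : A → B → C) xs ys →
  concatMap (λ x → map (f x) ys) xs ≡ cartesianProductWith f xs ys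
concatMap-map≡cartesianProductWith f [] ys = refl
concatMap-map≡cartesianProductWith f (x ∷ xs) ys =
  cong (map (f x) ys ++_) (concatMap-map≡cartesianProductWith f xs ys)

module _ (m : ℕ) where

  words-suc : ∀ k → words m (suc k) ≡ cartesianProductWith (λ w a → a ∷ w) (words m k) (allFin m)
  words-suc k = concatMap-map≡cartesianProductWith (λ w a → a ∷ w) (words m k) (allFin m)

  words-unique : ∀ k → Unique (words m k)
  words-unique zero = [] ∷ []
  words-unique (suc k) = subst Unique (sym (words-suc k))
    (UniqueP.cartesianProductWith⁺ _ (λ e → ∷-injectiveʳ e , ∷-injectiveˡ e)
      (words-unique k) (UniqueP.allFin⁺ m))

  ∈-words : ∀ w → w ∈ words m (length w)
  ∈-words [] = here refl
  ∈-words (a ∷ w) = subst (a ∷ w ∈_) (sym (words-suc (length w)))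
    (∈-cartesianProductWith⁺ (λ w a → a ∷ w) (∈-words w) (∈-allFin a))

  words-length : ∀ k {w} → w ∈ words m k → length w ≡ k
  words-length zero (here refl) = refl
  words-length (suc k) w∈
    with _ , _ , w′∈ , _ , refl ←
           ∈-cartesianProductWith⁻ (λ w a → a ∷ w) (words m k) (allFin m) (subst (_ ∈_) (words-suc k) w∈)
    = cong suc (words-length k w′∈)

module _ {m : ℕ} where

  T-≡ᶠ : ∀ {a b : Fin m} → T (a ≡ᶠ b) ⇔ a ≡ b
  T-≡ᶠ = mk⇔ (toℕ-injective ∘ ≡ᵇ⇒≡ _ _) (≡⇒≡ᵇ _ _ ∘ cong toℕ)

  T-any-≡ᶠ : ∀ {a : Fin m} {w} → T (any (a ≡ᶠ_) w) ⇔ a ∈ w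
  T-any-≡ᶠ = mk⇔ (Any.map (to T-≡ᶠ) ∘ to T-any) (from T-any ∘ Any.map (from T-≡ᶠ))

  T-distinct : ∀ {w : List (Fin m)} → T (distinct w) ⇔ Unique w
  T-distinct {[]} = mk⇔ (const []) (const _)
  T-distinct {a ∷ w} = mk⇔
    (λ t → let a∉w , dw = to T-∧ t in
           ¬Any⇒All¬ w (to T-not a∉w ∘ from T-any-≡ᶠ) ∷ to T-distinct dw)
    (λ { (a∉w ∷ uw) → from T-∧ (from T-not (All¬⇒¬Any a∉w ∘ to T-any-≡ᶠ) , from T-distinct uw) })

bounded⇒toℕ-image : ∀ {n x} → All (_< n) x → ∃ λ (w : List (Fin n)) → map toℕ w ≡ x
bounded⇒toℕ-image [] = [] , refl
bounded⇒toℕ-image (v<n ∷ x<n) =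
  let w , e = bounded⇒toℕ-image x<n in fromℕ< v<n ∷ w , cong₂ _∷_ (toℕ-fromℕ< v<n) e

∈-perms⇔ : ∀ {n x} → x ∈ perms n ⇔ IsPerm n x
∈-perms⇔ {n} = mk⇔ ∈-perms⁻ ∈-perms⁺
  where
  distinct? : (w : List (Fin n)) → Dec (T (distinct w))
  distinct? w = T? (distinct w)

  ∈-perms⁻ : ∀ {x} → x ∈ perms n → IsPerm n x
  ∈-perms⁻ x∈ with w , w∈ , refl ← ∈-map⁻ (map toℕ) x∈
    with w∈words , dw ← ∈-filter⁻ distinct? {xs = words n n} w∈ =
    isPerm (trans (length-map toℕ w) (words-length n n w∈words))
           (AllP.map⁺ (All.universal toℕ<n w))
           (UniqueP.map⁺ toℕ-injective (to T-distinct dw))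

  ∈-perms⁺ : ∀ {x} → IsPerm n x → x ∈ perms n
  ∈-perms⁺ (isPerm len x<n ux) with w , refl ← bounded⇒toℕ-image x<n =
    ∈-map⁺ (map toℕ) (∈-filter⁺ distinct? w∈words (from T-distinct (UniqueP.map⁻ ux)))
    where
    w∈words : w ∈ words n n
    w∈words = subst (λ k → w ∈ words n k) (trans (sym (length-map toℕ w)) len) (∈-words n w)

perms-unique : ∀ n → Unique (perms n)
perms-unique n =
  UniqueP.map⁺ (map-injective toℕ-injective) (UniqueP.filter⁺ (λ w → T? (distinct w)) (words-unique n n))

unique∧set⇒length≡ : ∀ {A : Set} {xs ys : List A} →
                      Unique xs → Unique ys → xs ∼[ set ] ys → length xs ≡ length ys
unique∧set⇒length≡ uxs uys xs∼ys = ↭-length (∼bag⇒↭ (unique∧set⇒bag uxs uys xs∼ys))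

unique∧bounded⇒length≤ : ∀ {m x} → Unique x → All (_< m) x → length x ≤ m
unique∧bounded⇒length≤ {m} {x} ux x<m = begin
  length x                         ≡⟨ unique∧set⇒length≡ ux (UniqueP.filter⁺ (_∈? x) (UniqueP.upTo⁺ m))
                                        (mk⇔ (λ v∈x → ∈-filter⁺ (_∈? x) (∈-upTo⁺ (All.lookup x<m v∈x)) v∈x)
                                             (proj₂ ∘ ∈-filter⁻ (_∈? x) {xs = upTo m})) ⟩
  length (filter (_∈? x) (upTo m)) ≤⟨ length-filter (_∈? x) (upTo m) ⟩
  length (upTo m)                  ≡⟨ length-upTo m ⟩
  m                                ∎
  where open ≤-Reasoning

bounded∧∉⇒bounded : ∀ {k x} → All (_< suc k) x → k ∉ x → All (_< k) x
bounded∧∉⇒bounded x<1+k k∉x =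
  All.zipWith (λ (v<1+k , k≢v) → ≤∧≢⇒< (s≤s⁻¹ v<1+k) (k≢v ∘ sym)) (x<1+k , ¬Any⇒All¬ _ k∉x)

IsPerm⇒max-∈ : ∀ {k x} → IsPerm (suc k) x → k ∈ x
IsPerm⇒max-∈ {k} {x} (isPerm len x<1+k ux) with k ∈? x
... | yes k∈x = k∈x
... | no k∉x =
  contradiction (subst (_≤ k) len (unique∧bounded⇒length≤ ux (bounded∧∉⇒bounded x<1+k k∉x))) 1+n≰n

IsPerm-resp-↭ : ∀ {n xs ys} → xs ↭ ys → IsPerm n xs → IsPerm n ys
IsPerm-resp-↭ xs↭ys (isPerm len xs<n uxs) =
  isPerm (trans (sym (↭-length xs↭ys)) len)
         (All-resp-↭ xs↭ys xs<n)
         (Unique-resp-↭ (setoid ℕ) (↭⇒↭ₛ xs↭ys) uxs)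

IsPerm-∷-max⇔ : ∀ {k y} → IsPerm (suc k) (k ∷ y) ⇔ IsPerm k y
IsPerm-∷-max⇔ {k} = mk⇔
  (λ { (isPerm len (_ ∷ y<1+k) (k∉y ∷ uy)) →
         isPerm (suc-injective len) (bounded∧∉⇒bounded y<1+k (All¬⇒¬Any k∉y)) uy })
  (λ { (isPerm len y<k uy) → isPerm (cong suc len) (n<1+n k ∷ All.map m<n⇒m<1+n y<k)
                                    (All.map (λ v<k k≡v → <-irrefl (sym k≡v) v<k) y<k ∷ uy) })

IsPerm-insert-max⇔ : ∀ {k} ys zs → IsPerm (suc k) (ys ++ k ∷ zs) ⇔ IsPerm k (ys ++ zs)
IsPerm-insert-max⇔ {k} ys zs = mk⇔
  (to IsPerm-∷-max⇔ ∘ IsPerm-resp-↭ (shift k ys zs))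
  (IsPerm-resp-↭ (↭-sym (shift k ys zs)) ∘ from IsPerm-∷-max⇔)

IsPerm-∷ʳ-max⇔ : ∀ {k y} → IsPerm (suc k) (y ++ [ k ]) ⇔ IsPerm k y
IsPerm-∷ʳ-max⇔ {k} {y} =
  subst (λ z → IsPerm (suc k) (y ++ [ k ]) ⇔ IsPerm k z) (++-identityʳ y) (IsPerm-insert-max⇔ y [])

Peak-mono : ∀ {xs ys} → xs ⊆ ys → Peak xs → Peak ys
Peak-mono xs⊆ys (peak s⊆xs a<b c<b) = peak (⊆-trans s⊆xs xs⊆ys) a<b c<b

Peak-reverse : ∀ {x} → Peak x → Peak (reverse x)
Peak-reverse (peak s⊆x a<b c<b) = peak (reverse⁺ s⊆x) c<b a<b

¬Peak-∷-max : ∀ {m y} → All (_< m) y → ¬ Peak y → ¬ Peak (m ∷ y)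
¬Peak-∷-max y<m ¬py (peak (_ ∷ʳ s⊆y) a<b c<b) = ¬py (peak s⊆y a<b c<b)
¬Peak-∷-max y<m ¬py (peak (refl ∷ bc⊆y) m<b _) = <-asym m<b (All.head (All-resp-⊆ bc⊆y y<m))

¬Peak-∷ʳ-max : ∀ {m y} → All (_< m) y → ¬ Peak y → ¬ Peak (y ++ [ m ])
¬Peak-∷ʳ-max {m} {y} y<m ¬py =
  ¬Peak-∷-max (All-resp-↭ (↭-sym (↭-reverse y)) y<m)
              (¬py ∘ subst Peak (reverse-involutive y) ∘ Peak-reverse)
  ∘ subst Peak (reverse-++ y [ m ])
  ∘ Peak-reverse

¬Peak⇒max-at-end : ∀ {m} ys zs → All (_< m) (ys ++ zs) → ¬ Peak (ys ++ m ∷ zs) → ys ≡ [] ⊎ zs ≡ []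
¬Peak⇒max-at-end [] zs _ _ = inj₁ refl
¬Peak⇒max-at-end (a ∷ ys) [] _ _ = inj₂ refl
¬Peak⇒max-at-end (a ∷ ys) (c ∷ zs) (a<m ∷ rest<m) ¬p =
  contradiction (peak (refl ∷ ++⁺ˡ ys (refl ∷ refl ∷ []⊆-universal zs)) a<m (All.head (AllP.++⁻ʳ ys rest<m)))
                ¬p

even-suc : ∀ n → even (suc n) ≡ not (even n)
even-suc zero = refl
even-suc (suc n) = sym (trans (cong not (even-suc n)) (not-involutive (even n)))

firstAscent-∷-max : ∀ {m c} w → c < m → firstAscent (m ∷ c ∷ w) ≡ suc (firstAscent (c ∷ w))
firstAscent-∷-max w c<m rewrite <ᵇ≡false (<⇒≤ c<m) = refl

firstAscent-∷ʳ-max : ∀ {m a} w → All (_< m) (a ∷ w) →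
                     firstAscent (a ∷ w ++ [ m ]) ≡ firstAscent (a ∷ w)
firstAscent-∷ʳ-max [] (a<m ∷ []) rewrite <ᵇ≡true a<m = refl
firstAscent-∷ʳ-max {a = a} (b ∷ w) (_ ∷ bw<m) with a <ᵇ b
... | true = refl
... | false = cong suc (firstAscent-∷ʳ-max w bw<m)

record PeakFreePerm (k : ℕ) (b : Bool) (x : List ℕ) : Set where
  constructor peakFreePerm
  field
    isPermutation : IsPerm (suc k) x
    peakFree      : ¬ Peak x
    parity        : even (firstAscent x) ≡ b

not-≡⇔≡-not : ∀ {x y} → not x ≡ y ⇔ x ≡ not y
not-≡⇔≡-not {x} = mk⇔ (λ { refl → sym (not-involutive x) }) (λ { refl → not-involutive _ })

PeakFreePerm-∷⇔ : ∀ {k b y} → PeakFreePerm (suc k) b (suc k ∷ y) ⇔ PeakFreePerm k (not b) y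
PeakFreePerm-∷⇔ {y = []} =
  mk⇔ (λ { (peakFreePerm (isPerm () _ _) _ _) }) (λ { (peakFreePerm (isPerm () _ _) _ _) })
PeakFreePerm-∷⇔ {k} {b} {c ∷ w} = mk⇔
  (λ { (peakFreePerm perm ¬px par) → let perm′ = to IsPerm-∷-max⇔ perm in
         peakFreePerm perm′ (¬px ∘ Peak-mono (_ ∷ʳ ⊆-refl))
                      (to not-≡⇔≡-not (trans (sym (parity-∷ (IsPerm.bounded perm′))) par)) })
  (λ { (peakFreePerm perm ¬py par) →
         peakFreePerm (from IsPerm-∷-max⇔ perm) (¬Peak-∷-max (IsPerm.bounded perm) ¬py)
                      (trans (parity-∷ (IsPerm.bounded perm)) (from not-≡⇔≡-not par)) })
  where
  parity-∷ : All (_< suc k) (c ∷ w) →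
             even (firstAscent (suc k ∷ c ∷ w)) ≡ not (even (firstAscent (c ∷ w)))
  parity-∷ (c<1+k ∷ _) = trans (cong even (firstAscent-∷-max w c<1+k)) (even-suc (firstAscent (c ∷ w)))

PeakFreePerm-∷ʳ⇔ : ∀ {k b y} → PeakFreePerm (suc k) b (y ++ [ suc k ]) ⇔ PeakFreePerm k b y
PeakFreePerm-∷ʳ⇔ {y = []} =
  mk⇔ (λ { (peakFreePerm (isPerm () _ _) _ _) }) (λ { (peakFreePerm (isPerm () _ _) _ _) })
PeakFreePerm-∷ʳ⇔ {k} {b} {c ∷ w} = mk⇔
  (λ { (peakFreePerm perm ¬px par) → let perm′ = to IsPerm-∷ʳ-max⇔ perm in
         peakFreePerm perm′ (¬px ∘ Peak-mono (++⁺ʳ [ suc k ] ⊆-refl))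
                      (trans (sym (cong even (firstAscent-∷ʳ-max w (IsPerm.bounded perm′)))) par) })
  (λ { (peakFreePerm perm ¬py par) →
         peakFreePerm (from IsPerm-∷ʳ-max⇔ perm) (¬Peak-∷ʳ-max (IsPerm.bounded perm) ¬py)
                      (trans (cong even (firstAscent-∷ʳ-max w (IsPerm.bounded perm))) par) })

peakFreePerms : ℕ → Bool → List (List ℕ)
peakFreePerms zero true = []
peakFreePerms zero false = (0 ∷ []) ∷ []
peakFreePerms (suc k) b =
  map (suc k ∷_) (peakFreePerms k (not b)) ++ map (_++ [ suc k ]) (peakFreePerms k b)

∈-peakFreePerms⁻ : ∀ {k b x} → x ∈ peakFreePerms k b → PeakFreePerm k b x
∈-peakFreePerms⁻ {zero} {false} (here refl) =
  peakFreePerm (isPerm refl (z<s ∷ []) ([] ∷ [])) (λ { (peak (_ ∷ʳ ()) _ _) ; (peak (_ ∷ ()) _ _) }) refl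
∈-peakFreePerms⁻ {suc k} {b} x∈ with ∈-++⁻ (map (suc k ∷_) (peakFreePerms k (not b))) x∈
... | inj₁ x∈ˡ with _ , y∈ , refl ← ∈-map⁻ (suc k ∷_) x∈ˡ =
  from PeakFreePerm-∷⇔ (∈-peakFreePerms⁻ y∈)
... | inj₂ x∈ʳ with _ , y∈ , refl ← ∈-map⁻ (_++ [ suc k ]) x∈ʳ =
  from PeakFreePerm-∷ʳ⇔ (∈-peakFreePerms⁻ y∈)

∈-peakFreePerms⁺ : ∀ {k b x} → PeakFreePerm k b x → x ∈ peakFreePerms k b
∈-peakFreePerms⁺ {zero} {x = []} (peakFreePerm (isPerm () _ _) _ _)
∈-peakFreePerms⁺ {zero} {x = _ ∷ []} (peakFreePerm (isPerm _ (z<s ∷ []) _) _ refl) = here refl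
∈-peakFreePerms⁺ {zero} {x = _ ∷ _ ∷ _} (peakFreePerm (isPerm () _ _) _ _)
∈-peakFreePerms⁺ {suc k} pf@(peakFreePerm perm ¬px _)
  with ys , zs , refl ← ∈-∃++ (IsPerm⇒max-∈ perm)
  with ¬Peak⇒max-at-end ys zs (IsPerm.bounded (to (IsPerm-insert-max⇔ ys zs) perm)) ¬px
... | inj₁ refl = ∈-++⁺ˡ (∈-map⁺ _ (∈-peakFreePerms⁺ (to PeakFreePerm-∷⇔ pf)))
... | inj₂ refl = ∈-++⁺ʳ _ (∈-map⁺ _ (∈-peakFreePerms⁺ (to PeakFreePerm-∷ʳ⇔ pf)))

∈-peakFreePerms⇔ : ∀ {k b x} → x ∈ peakFreePerms k b ⇔ PeakFreePerm k b x
∈-peakFreePerms⇔ = mk⇔ ∈-peakFreePerms⁻ ∈-peakFreePerms⁺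

peakFreePerms-unique : ∀ k b → Unique (peakFreePerms k b)
peakFreePerms-unique zero true = []
peakFreePerms-unique zero false = [] ∷ []
peakFreePerms-unique (suc k) b =
  UniqueP.++⁺ (UniqueP.map⁺ ∷-injectiveʳ (peakFreePerms-unique k (not b)))
              (UniqueP.map⁺ (∷ʳ-injectiveˡ _ _) (peakFreePerms-unique k b))
              disjoint
  where
  max-not-first : ∀ {y} z → IsPerm (suc k) z → suc k ∷ y ≢ z ++ [ suc k ]
  max-not-first (c ∷ _) (isPerm _ (c<1+k ∷ _) _) e = <-irrefl (∷-injectiveˡ (sym e)) c<1+k

  disjoint : Disjoint (map (suc k ∷_) (peakFreePerms k (not b))) (map (_++ [ suc k ]) (peakFreePerms k b))
  disjoint (x∈ˡ , x∈ʳ)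
    with _ , _ , refl ← ∈-map⁻ (suc k ∷_) x∈ˡ | z , z∈ , e ← ∈-map⁻ (_++ [ suc k ]) x∈ʳ =
    max-not-first z (PeakFreePerm.isPermutation (∈-peakFreePerms⁻ z∈)) e

length-peakFreePerms : ∀ k b → length (peakFreePerms (suc k) b) ≡ 2 ^ k
length-peakFreePerms zero true = refl
length-peakFreePerms zero false = refl
length-peakFreePerms (suc k) b = begin
  length (peakFreePerms (suc (suc k)) b)
    ≡⟨ length-++ (map (suc (suc k) ∷_) (peakFreePerms (suc k) (not b))) ⟩
  length (map (suc (suc k) ∷_) (peakFreePerms (suc k) (not b)))
    + length (map (_++ [ suc (suc k) ]) (peakFreePerms (suc k) b))
    ≡⟨ cong₂ _+_ (length-map _ (peakFreePerms (suc k) (not b))) (length-map _ (peakFreePerms (suc k) b)) ⟩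
  length (peakFreePerms (suc k) (not b)) + length (peakFreePerms (suc k) b)
    ≡⟨ cong₂ _+_ (length-peakFreePerms k (not b)) (length-peakFreePerms k b) ⟩
  2 ^ k + 2 ^ k
    ≡⟨ cong (2 ^ k +_) (sym (+-identityʳ (2 ^ k))) ⟩
  2 ^ suc k ∎
  where open ≡-Reasoning

∈-avoidingDesarrangements⇔ : ∀ {k x} →
  x ∈ filter (λ π → T? (isDesarrangement π ∧ avoidsAll π Π)) (perms (suc k)) ⇔ PeakFreePerm k true x
∈-avoidingDesarrangements⇔ {k} = mk⇔
  (λ x∈ → let x∈perms , t = ∈-filter⁻ P? {xs = perms (suc k)} x∈
              perm = to ∈-perms⇔ x∈perms
              des , avoids = to T-∧ t in
          peakFreePerm perm (to (avoids-132-231⇔¬Peak (IsPerm.unique perm)) avoids) (to T-≡ des))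
  (λ { (peakFreePerm perm ¬px par) →
         ∈-filter⁺ P? (from ∈-perms⇔ perm)
           (from T-∧ (from T-≡ par , from (avoids-132-231⇔¬Peak (IsPerm.unique perm)) ¬px)) })
  where
  P? : (π : List ℕ) → Dec (T (isDesarrangement π ∧ avoidsAll π Π))
  P? π = T? (isDesarrangement π ∧ avoidsAll π Π)

theorem3p14 : (n : ℕ) → 2 ≤ n →
    d n ((1 ∷ 3 ∷ 2 ∷ []) ∷ (2 ∷ 3 ∷ 1 ∷ []) ∷ []) ≡ 2 ^ (n ∸ 2)
theorem3p14 (suc zero) (s≤s ())
theorem3p14 (suc (suc k)) _ = begin
  d (suc (suc k)) Π
    ≡⟨ unique∧set⇒length≡ (UniqueP.filter⁺ _ (perms-unique (suc (suc k))))
                          (peakFreePerms-unique (suc k) true)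
                          (⇔.trans (∈-avoidingDesarrangements⇔ {suc k}) (⇔.sym ∈-peakFreePerms⇔)) ⟩
  length (peakFreePerms (suc k) true)
    ≡⟨ length-peakFreePerms k true ⟩
  2 ^ k ∎
  where open ≡-Reasoning
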